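{- Let $G$ be a complete $3$-partite graph with parts $V_1,V_2,V_3$, and assume $G\not\cong K_3$. Then $\chi^{ven}(G)=1$ if $|V_i|\neq |V_j|$ for all $1\le i<j\le 3$, and $\chi^{ven}(G)=2$ otherwise.
   Context: All graphs are simple and undirected. For a total weighting $w:V(G)\cup E(G)\to\{1,\dots,k\}$ and a vertex $v$, put $\sigma^{ven}(v)=w(v)+\sum_{e\ni v}w(e)+\sum_{u\in N(v)}w(u)$, where $N(v)$ is the open neighborhood of $v$. The weighting is a neighbor full sum distinguishing total $k$-coloring if $\sigma^{ven}(u)\ne\sigma^{ven}(v)$ for every edge $uv$. $\chi^{ven}(G)$ is the minimum $k$ for which such a weighting exists. A complete $3$-partite graph has vertex set partitioned into three nonempty parts, two vertices being adjacent iff they lie in different parts. -}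

module Defs where

open import Data.Nat using (ℕ; zero; suc; _+_; _≤_)
open import Data.Fin using (Fin; _≟_)
open import Data.Nat.ListAction using (sum)
open import Data.List using (List; map; filter; length; allFin)
open import Data.Product using (Σ; _×_; ∃; ∃-syntax)
open import Relation.Nullary using (¬_; Dec; yes; no)
open import Relation.Binary.PropositionalEquality using (_≡_; _≢_)
open import Relation.Binary using (Decidable)
open import Function.Bundles using (_⇔_)
open import Level using (suc; zero)

record Graph (n : ℕ) : Set₁ where
  field
    Adj    : Fin n → Fin n → Set
    adj?   : Decidable Adj
    sym    : ∀ {u v} → Adj u v → Adj v u
    irrefl : ∀ {v} → ¬ Adj v v
open Graph public

K₃ : Graph 3
K₃ = record
  { Adj = λ i j → i ≢ j
  ; adj? = λ i j → ¬? (i ≟ j)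
  ; sym = λ p q → p (Relation.Binary.PropositionalEquality.sym q)
  ; irrefl = λ p → p Relation.Binary.PropositionalEquality.refl }
  where open import Relation.Nullary using (¬?)

_≅_ : ∀ {n m} → Graph n → Graph m → Set
_≅_ {n} {m} G H =
  Σ (Fin n → Fin m) λ f → Σ (Fin m → Fin n) λ g →
    (∀ x → g (f x) ≡ x) × (∀ y → f (g y) ≡ y) ×
    (∀ u v → Adj G u v ⇔ Adj H (f u) (f v))

-- A total weighting w : V(G) ∪ E(G) → {1,…,k}.  Edge weights are given by a
-- symmetric function on ordered pairs; only its values on edges matter.
record TotalWeighting {n : ℕ} (G : Graph n) (k : ℕ) : Set where
  field
    wv     : Fin n → ℕ
    we     : Fin n → Fin n → ℕ
    we-sym : ∀ u v → we u v ≡ we v u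
    wv-range : ∀ v → 1 ≤ wv v × wv v ≤ k
    we-range : ∀ u v → Adj G u v → 1 ≤ we u v × we u v ≤ k
open TotalWeighting public

nbrTerm : ∀ {n k} (G : Graph n) → TotalWeighting G k → Fin n → Fin n → ℕ
nbrTerm G w v u with adj? G v u
... | yes _ = we w v u + wv w u
... | no  _ = 0

-- σ^{ven}(v) = w(v) + Σ_{e ∋ v} w(e) + Σ_{u ∈ N(v)} w(u)
σven : ∀ {n k} (G : Graph n) → TotalWeighting G k → Fin n → ℕ
σven {n} G w v = wv w v + sum (map (nbrTerm G w v) (allFin n))

IsNFSD : ∀ {n k} (G : Graph n) → TotalWeighting G k → Set
IsNFSD G w = ∀ u v → Adj G u v → σven G w u ≢ σven G w v

HasNFSD : ∀ {n} → Graph n → ℕ → Set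
HasNFSD G k = Σ (TotalWeighting G k) λ w → IsNFSD G w

χven≡ : ∀ {n} → Graph n → ℕ → Set
χven≡ G m = HasNFSD G m × (∀ k → HasNFSD G k → m ≤ k)

IsComplete3PartiteWith : ∀ {n} → Graph n → (Fin n → Fin 3) → Set
IsComplete3PartiteWith {n} G part =
  (∀ i → ∃[ v ] part v ≡ i) × (∀ u v → Adj G u v ⇔ (part u ≢ part v))

partSize : ∀ {n} → (Fin n → Fin 3) → Fin 3 → ℕ
partSize {n} part i = length (filter (λ v → part v ≟ i) (allFin n))

-- A weighting that is constant on the parts makes σ^ven constant on the parts, so it is
-- distinguishing iff the values partσ of the parts are pairwise distinct.  With all
-- weights 1 a vertex of V_i has σ^ven = 1 + 2(n - |V_i|): this gives χ^ven = 1 when the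
-- part sizes are distinct, and rules out k = 1 otherwise.  If |V_0| = |V_1| = a and
-- |V_2| = m (after relabelling the parts), give weight 2 to the edges between V_1 and V_2
-- and vertex weights (1,1,2) if a < m, (2,2,1) if m ≤ a.  The three values are then
-- separated by their size and by a residue mod 3, resp. mod 2; the only exception,
-- a = m = 1, is G ≅ K₃.
module Submission where

open import Defs hiding (sym)
open import Data.Bool using (true; false; if_then_else_; _∨_)
open import Data.Bool.Properties using (∨-comm)
open import Data.Empty using (⊥-elim)
open import Data.Fin using (Fin; zero; suc; _<_; _<?_)
open import Data.Fin.Patterns using (0F; 1F; 2F)
open import Data.Fin.Permutation
  using (Permutation′; _⟨$⟩ʳ_; _⟨$⟩ˡ_; inverseˡ; inverseʳ; transpose; id)
import Data.Fin.Properties as FinP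
open FinP using (_≟_; all?; ¬∀⟶∃¬; <-cmp)
open import Data.List using (List; []; _∷_; map; filter; length; tabulate; allFin)
open import Data.List.Membership.Propositional using (_∈_)
open import Data.List.Membership.Propositional.Properties using (∈-filter⁺; ∈-allFin; ∈-length)
open import Data.List.Properties using (map-cong; tabulate-cong; filter-≐)
open import Data.List.Relation.Unary.Any using (here; there)
open import Data.Nat as ℕ using (ℕ; zero; suc; _+_; _*_; _≤_; _≤?_; z≤n; s≤s; z<s)
open import Data.Nat.Divisibility using (_∣_; ∣m+n∣m⇒∣n; m∣m*n; ∣1⇒≡1)
open import Data.Nat.ListAction using (sum)
import Data.Nat.Properties
open Data.Nat.Properties
  using (+-identityʳ; +-comm; +-cancelˡ-≡; +-cancelʳ-≡; *-cancelˡ-≡; m<m+n; <⇒≢; >⇒≢; ≮⇒≥;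
         n≮0; n≮n; ≰⇒>; ≤-refl; ≤-trans; ≤-antisym; ≤∧≢⇒<; m≤n⇒m≤1+n; m≤n⇒∃[o]m+o≡n;
         +-monoʳ-≤; +-monoʳ-<; *-monoˡ-≤; module ≤-Reasoning)
  renaming (_≟_ to _≟ℕ_)
open import Algebra.Properties.CommutativeSemigroup Data.Nat.Properties.+-commutativeSemigroup
  using (interchange)
open import Data.Nat.Tactic.RingSolver using (solve-∀)
open import Data.Product using (_×_; _,_; proj₁; proj₂; ∃₂)
open import Function using (_∘_)
open import Function.Bundles using (_⇔_; mk⇔; Equivalence)
open import Relation.Binary.Definitions using (tri<; tri≈; tri>)
open import Relation.Nullary using (¬_; yes; no; does; ¬?; _→-dec_; decidable-stable)
open import Relation.Binary.PropositionalEquality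
  using (_≡_; _≢_; refl; sym; trans; cong; cong₂; subst; subst₂; _≗_; ≢-sym; module ≡-Reasoning)

open Equivalence using (to; from)

∑ : ∀ {r} → (Fin r → ℕ) → ℕ
∑ f = sum (tabulate f)

∑-cong : ∀ {r} {f g : Fin r → ℕ} → f ≗ g → ∑ f ≡ ∑ g
∑-cong = cong sum ∘ tabulate-cong

∑-zero : ∀ r → ∑ {r} (λ _ → 0) ≡ 0
∑-zero zero    = refl
∑-zero (suc r) = ∑-zero r

∑-distrib-+ : ∀ {r} (f g : Fin r → ℕ) → ∑ (λ j → f j + g j) ≡ ∑ f + ∑ g
∑-distrib-+ {zero}  f g = refl
∑-distrib-+ {suc r} f g = trans (cong (f zero + g zero +_) (∑-distrib-+ (f ∘ suc) (g ∘ suc)))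
                                (interchange (f zero) (g zero) (∑ (f ∘ suc)) (∑ (g ∘ suc)))

∑-select : ∀ {r} i (h : Fin r → ℕ) → ∑ (λ j → if does (i ≟ j) then h j else 0) ≡ h i
∑-select {suc r} zero    h = trans (cong (h zero +_) (∑-zero r)) (+-identityʳ (h zero))
∑-select {suc r} (suc i) h = ∑-select i (h ∘ suc)

count : ∀ {n r} → (Fin n → Fin r) → List (Fin n) → Fin r → ℕ
count part xs i = length (filter (λ v → part v ≟ i) xs)

count-∷-* : ∀ {n r} (part : Fin n → Fin r) x xs j (h : Fin r → ℕ) →
  count part (x ∷ xs) j * h j ≡ (if does (part x ≟ j) then h j else 0) + count part xs j * h j
count-∷-* part x xs j h with does (part x ≟ j)
... | true  = refl
... | false = refl

sum-map-∘-part : ∀ {n r} (part : Fin n → Fin r) (h : Fin r → ℕ) xs →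
  sum (map (h ∘ part) xs) ≡ ∑ (λ j → count part xs j * h j)
sum-map-∘-part {r = r} part h [] = sym (∑-zero r)
sum-map-∘-part part h (x ∷ xs) = begin
  h (part x) + sum (map (h ∘ part) xs)      ≡⟨ cong₂ _+_ (sym (∑-select (part x) h))
                                                          (sum-map-∘-part part h xs) ⟩
  ∑ (λ j → hit j) + ∑ (λ j → rest j)        ≡⟨ sym (∑-distrib-+ hit rest) ⟩
  ∑ (λ j → hit j + rest j)                  ≡⟨ ∑-cong (λ j → sym (count-∷-* part x xs j h)) ⟩
  ∑ (λ j → count part (x ∷ xs) j * h j)     ∎
  where
  open ≡-Reasoning
  hit rest : Fin _ → ℕ
  hit j  = if does (part x ≟ j) then h j else 0
  rest j = count part xs j * h j

count-relabel : ∀ {n r} (π : Permutation′ r) (part : Fin n → Fin r) xs i →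
  count ((π ⟨$⟩ʳ_) ∘ part) xs i ≡ count part xs (π ⟨$⟩ˡ i)
count-relabel π part xs i = cong length (filter-≐ _ _
  ((λ eq → trans (sym (inverseˡ π)) (cong (π ⟨$⟩ˡ_) eq)) , (λ eq → trans (cong (π ⟨$⟩ʳ_) eq) (inverseʳ π)))
  xs)

∈-≢-∈⇒2≤length : ∀ {A : Set} {x y : A} {xs} → x ∈ xs → y ∈ xs → x ≢ y → 2 ≤ length xs
∈-≢-∈⇒2≤length (here refl) (here refl) x≢y = ⊥-elim (x≢y refl)
∈-≢-∈⇒2≤length (here _)    (there y∈)  _   = s≤s (∈-length y∈)
∈-≢-∈⇒2≤length (there x∈)  (here _)    _   = s≤s (∈-length x∈)
∈-≢-∈⇒2≤length (there x∈)  (there y∈)  x≢y = m≤n⇒m≤1+n (∈-≢-∈⇒2≤length x∈ y∈ x≢y)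

<-distinct⇒injective : ∀ {r} (f : Fin r → ℕ) → (∀ i j → i < j → f i ≢ f j) →
  ∀ {i j} → i ≢ j → f i ≢ f j
<-distinct⇒injective f distinct {i} {j} i≢j with <-cmp i j
... | tri< i<j _ _ = distinct i j i<j
... | tri≈ _ i≡j _ = ⊥-elim (i≢j i≡j)
... | tri> _ _ j<i = ≢-sym (distinct j i j<i)

¬<-distinct⇒equal-pair : ∀ {r} (f : Fin r → ℕ) → ¬ (∀ i j → i < j → f i ≢ f j) →
  ∃₂ λ i j → i < j × f i ≡ f j
¬<-distinct⇒equal-pair {r} f ¬distinct =
  let i , ¬∀j = ¬∀⟶∃¬ r _ (λ i → all? (P? i)) ¬distinct
      j , ¬Pij = ¬∀⟶∃¬ r _ (P? i) ¬∀j
  in i , j , decidable-stable (i <? j) (λ i≮j → ¬Pij (⊥-elim ∘ i≮j))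
           , decidable-stable (f i ≟ℕ f j) (λ fi≢fj → ¬Pij (λ _ → fi≢fj))
  where
  P? : ∀ i j → _
  P? i j = (i <? j) →-dec ¬? (f i ≟ℕ f j)

crossWeight : ∀ {r} → (Fin r → ℕ) → (Fin r → Fin r → ℕ) → Fin r → Fin r → ℕ
crossWeight c e i j = if does (i ≟ j) then 0 else e i j + c j

-- σ^ven of a vertex of part i of a complete multipartite graph with part sizes S, when
-- the vertices of part j have weight c j and the edges between parts i and j weight e i j.
partσ : ∀ {r} → (S c : Fin r → ℕ) → (Fin r → Fin r → ℕ) → Fin r → ℕ
partσ S c e i = c i + ∑ (λ j → S j * crossWeight c e i j)

uniformσ : ∀ {r} → (Fin r → ℕ) → Fin r → ℕ
uniformσ S = partσ S (λ _ → 1) (λ _ _ → 1)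

partσ-cong : ∀ {r} {S S' : Fin r → ℕ} c e → S ≗ S' → partσ S c e ≗ partσ S' c e
partσ-cong c e S≗S' i = cong (c i +_) (∑-cong (λ j → cong (_* crossWeight c e i j) (S≗S' j)))

InRange : ℕ → ℕ → Set
InRange k x = 1 ≤ x × x ≤ k

InRange-1 : ∀ {x} → InRange 1 x → x ≡ 1
InRange-1 (1≤x , x≤1) = ≤-antisym x≤1 1≤x

module CompleteMultipartite {n r} (G : Graph n) (part : Fin n → Fin r)
  (adj⇔ : ∀ u v → Adj G u v ⇔ (part u ≢ part v)) where

  size : Fin r → ℕ
  size = count part (allFin n)

  module _ {k} (w : TotalWeighting G k) (c : Fin r → ℕ) (e : Fin r → Fin r → ℕ)
    (wv≡c : ∀ v → wv w v ≡ c (part v))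
    (we≡e : ∀ u v → Adj G u v → we w u v ≡ e (part u) (part v)) where

    nbrTerm-partConstant : ∀ v u → nbrTerm G w v u ≡ crossWeight c e (part v) (part u)
    nbrTerm-partConstant v u with adj? G v u | part v ≟ part u
    ... | yes uv | yes same = ⊥-elim (to (adj⇔ v u) uv same)
    ... | yes uv | no _     = cong₂ _+_ (we≡e v u uv) (wv≡c u)
    ... | no _   | yes _    = refl
    ... | no ¬uv | no diff  = ⊥-elim (¬uv (from (adj⇔ v u) diff))

    σven-partConstant : ∀ v → σven G w v ≡ partσ size c e (part v)
    σven-partConstant v = cong₂ _+_ (wv≡c v)
      (trans (cong sum (map-cong (nbrTerm-partConstant v) (allFin n)))
             (sum-map-∘-part part (crossWeight c e (part v)) (allFin n)))

  partConstantWeighting : ∀ k (c : Fin r → ℕ) (e : Fin r → Fin r → ℕ) → (∀ i j → e i j ≡ e j i) →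
    (∀ i → InRange k (c i)) → (∀ i j → InRange k (e i j)) → TotalWeighting G k
  partConstantWeighting k c e e-sym c-range e-range = record
    { wv       = c ∘ part
    ; we       = λ u v → e (part u) (part v)
    ; we-sym   = λ u v → e-sym (part u) (part v)
    ; wv-range = c-range ∘ part
    ; we-range = λ u v _ → e-range (part u) (part v)
    }

  hasNFSD-if-partσ-injective : ∀ k (c : Fin r → ℕ) (e : Fin r → Fin r → ℕ) →
    (∀ i j → e i j ≡ e j i) → (∀ i → InRange k (c i)) → (∀ i j → InRange k (e i j)) →
    (∀ {i j} → i ≢ j → partσ size c e i ≢ partσ size c e j) → HasNFSD G k
  hasNFSD-if-partσ-injective k c e e-sym c-range e-range injective = w , nfsd
    where
    w : TotalWeighting G k
    w = partConstantWeighting k c e e-sym c-range e-range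

    σ≡ : ∀ v → σven G w v ≡ partσ size c e (part v)
    σ≡ = σven-partConstant w c e (λ _ → refl) (λ _ _ _ → refl)

    nfsd : IsNFSD G w
    nfsd u v uv σu≡σv = injective (to (adj⇔ u v) uv) (trans (sym (σ≡ u)) (trans σu≡σv (σ≡ v)))

  ¬HasNFSD-1 : ∀ {u v} → part u ≢ part v → uniformσ size (part u) ≡ uniformσ size (part v) →
    ¬ HasNFSD G 1
  ¬HasNFSD-1 {u} {v} diff σu≡σv (w , nfsd) =
    nfsd u v (from (adj⇔ u v) diff) (trans (σ≡ u) (trans σu≡σv (sym (σ≡ v))))
    where
    σ≡ : ∀ v → σven G w v ≡ uniformσ size (part v)
    σ≡ = σven-partConstant w _ _ (InRange-1 ∘ wv-range w) (λ u v → InRange-1 ∘ we-range w u v)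

¬HasNFSD-0 : ∀ {n} {G : Graph n} → Fin n → ¬ HasNFSD G 0
¬HasNFSD-0 v (w , _) = n≮0 (≤-trans (proj₁ (wv-range w v)) (proj₂ (wv-range w v)))

χven≡-intro : ∀ {n m} {G : Graph n} → HasNFSD G m → (∀ {k} → k ℕ.< m → ¬ HasNFSD G k) →
  χven≡ G m
χven≡-intro has below = has , λ k has-k → ≮⇒≥ (λ k<m → below k<m has-k)

relabel-complete : ∀ {n} {G : Graph n} {part} (π : Permutation′ 3) →
  IsComplete3PartiteWith G part → IsComplete3PartiteWith G ((π ⟨$⟩ʳ_) ∘ part)
relabel-complete π (nonempty , adj⇔) =
  (λ i → let v , pv = nonempty (π ⟨$⟩ˡ i) in v , trans (cong (π ⟨$⟩ʳ_) pv) (inverseʳ π)) ,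
  λ u v → mk⇔ (λ uv eq → to (adj⇔ u v) uv (π-injective eq))
              (λ diff → from (adj⇔ u v) (diff ∘ cong (π ⟨$⟩ʳ_)))
  where
  π-injective : ∀ {i j} → π ⟨$⟩ʳ i ≡ π ⟨$⟩ʳ j → i ≡ j
  π-injective eq = trans (sym (inverseˡ π)) (trans (cong (π ⟨$⟩ˡ_) eq) (inverseˡ π))

≢-by-gap : ∀ {x y k} → 0 ℕ.< k → y ≡ x + k → x ≢ y
≢-by-gap {x} 0<k y≡x+k x≡y = <⇒≢ (m<m+n x 0<k) (trans x≡y y≡x+k)

d*m≢1+d*n : ∀ d m n → 1 ℕ.< d → d * m ≢ 1 + d * n
d*m≢1+d*n d m n 1<d eq = >⇒≢ 1<d (∣1⇒≡1 (∣m+n∣m⇒∣n d∣dn+1 (m∣m*n n)))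
  where
  d∣dn+1 : d ∣ d * n + 1
  d∣dn+1 = subst (d ∣_) (trans eq (+-comm 1 (d * n))) (m∣m*n m)

triple : ∀ {A : Set} → A → A → A → Fin 3 → A
triple x y z 0F = x
triple x y z 1F = y
triple x y z 2F = z

triple-range : ∀ {k x y z} → InRange k x → InRange k y → InRange k z →
  ∀ i → InRange k (triple x y z i)
triple-range x∈ y∈ z∈ 0F = x∈
triple-range x∈ y∈ z∈ 1F = y∈
triple-range x∈ y∈ z∈ 2F = z∈

Distinct₃ : (Fin 3 → ℕ) → Set
Distinct₃ f = f 0F ≢ f 1F × f 0F ≢ f 2F × f 1F ≢ f 2F

Distinct₃⇒≢ : ∀ {f} → Distinct₃ f → ∀ {i j} → i ≢ j → f i ≢ f j
Distinct₃⇒≢ d {0F} {0F} i≢j = ⊥-elim (i≢j refl)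
Distinct₃⇒≢ d {0F} {1F} _   = proj₁ d
Distinct₃⇒≢ d {0F} {2F} _   = proj₁ (proj₂ d)
Distinct₃⇒≢ d {1F} {0F} _   = ≢-sym (proj₁ d)
Distinct₃⇒≢ d {1F} {1F} i≢j = ⊥-elim (i≢j refl)
Distinct₃⇒≢ d {1F} {2F} _   = proj₂ (proj₂ d)
Distinct₃⇒≢ d {2F} {0F} _   = ≢-sym (proj₁ (proj₂ d))
Distinct₃⇒≢ d {2F} {1F} _   = ≢-sym (proj₂ (proj₂ d))
Distinct₃⇒≢ d {2F} {2F} i≢j = ⊥-elim (i≢j refl)

Distinct₃-resp-≗ : ∀ {f g} → f ≗ g → Distinct₃ g → Distinct₃ f
Distinct₃-resp-≗ {f} {g} f≗g (d₀₁ , d₀₂ , d₁₂) = transfer d₀₁ , transfer d₀₂ , transfer d₁₂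
  where
  transfer : ∀ {i j} → g i ≢ g j → f i ≢ f j
  transfer {i} {j} gi≢gj fi≡fj = gi≢gj (trans (sym (f≗g i)) (trans fi≡fj (f≗g j)))

partσ-Fin3 : ∀ S c e → partσ S c e ≗ triple
  (c 0F + S 1F * (e 0F 1F + c 1F) + S 2F * (e 0F 2F + c 2F))
  (c 1F + S 0F * (e 1F 0F + c 0F) + S 2F * (e 1F 2F + c 2F))
  (c 2F + S 0F * (e 2F 0F + c 0F) + S 1F * (e 2F 1F + c 1F))
partσ-Fin3 S c e 0F = drop₀ (c 0F) (S 0F) (S 1F) (S 2F) _ _
  where
  drop₀ : ∀ c s₀ s₁ s₂ x y → c + (s₀ * 0 + (s₁ * x + (s₂ * y + 0))) ≡ c + s₁ * x + s₂ * y
  drop₀ = solve-∀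
partσ-Fin3 S c e 1F = drop₁ (c 1F) (S 0F) (S 1F) (S 2F) _ _
  where
  drop₁ : ∀ c s₀ s₁ s₂ x y → c + (s₀ * x + (s₁ * 0 + (s₂ * y + 0))) ≡ c + s₀ * x + s₂ * y
  drop₁ = solve-∀
partσ-Fin3 S c e 2F = drop₂ (c 2F) (S 0F) (S 1F) (S 2F) _ _
  where
  drop₂ : ∀ c s₀ s₁ s₂ x y → c + (s₀ * x + (s₁ * y + (s₂ * 0 + 0))) ≡ c + s₀ * x + s₁ * y
  drop₂ = solve-∀

uniformσ+2*S : ∀ S i → uniformσ S i + 2 * S i ≡ 1 + 2 * (S 0F + S 1F + S 2F)
uniformσ+2*S S i = trans (cong (_+ 2 * S i) (partσ-Fin3 S (λ _ → 1) (λ _ _ → 1) i)) (regroup i)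
  where
  regroup : ∀ i → triple (1 + S 1F * 2 + S 2F * 2) (1 + S 0F * 2 + S 2F * 2)
                         (1 + S 0F * 2 + S 1F * 2) i + 2 * S i ≡ 1 + 2 * (S 0F + S 1F + S 2F)
  regroup 0F = ring₀ (S 0F) (S 1F) (S 2F)
    where
    ring₀ : ∀ x y z → 1 + y * 2 + z * 2 + 2 * x ≡ 1 + 2 * (x + y + z)
    ring₀ = solve-∀
  regroup 1F = ring₁ (S 0F) (S 1F) (S 2F)
    where
    ring₁ : ∀ x y z → 1 + x * 2 + z * 2 + 2 * y ≡ 1 + 2 * (x + y + z)
    ring₁ = solve-∀
  regroup 2F = ring₂ (S 0F) (S 1F) (S 2F)
    where
    ring₂ : ∀ x y z → 1 + x * 2 + y * 2 + 2 * z ≡ 1 + 2 * (x + y + z)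
    ring₂ = solve-∀

uniformσ-≡⇔ : ∀ S i j → uniformσ S i ≡ uniformσ S j ⇔ S i ≡ S j
uniformσ-≡⇔ S i j = mk⇔
  (λ σi≡σj → *-cancelˡ-≡ (S i) (S j) 2 (+-cancelˡ-≡ (uniformσ S i) _ _
    (trans (uniformσ+2*S S i) (sym (trans (cong (_+ 2 * S j) σi≡σj) (uniformσ+2*S S j))))))
  (λ Si≡Sj → +-cancelʳ-≡ (2 * S i) _ _
    (trans (uniformσ+2*S S i)
           (sym (trans (cong (λ s → uniformσ S j + 2 * s) Si≡Sj) (uniformσ+2*S S j)))))

e₁₂ : Fin 3 → Fin 3 → ℕ
e₁₂ i j = if does (i ≟ 0F) ∨ does (j ≟ 0F) then 1 else 2

e₁₂-sym : ∀ i j → e₁₂ i j ≡ e₁₂ j i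
e₁₂-sym i j = cong (λ b → if b then 1 else 2) (∨-comm (does (i ≟ 0F)) (does (j ≟ 0F)))

e₁₂-range : ∀ i j → InRange 2 (e₁₂ i j)
e₁₂-range i j with does (i ≟ 0F) ∨ does (j ≟ 0F)
... | true  = s≤s z≤n , s≤s z≤n
... | false = s≤s z≤n , s≤s (s≤s z≤n)

cᴬ cᴮ : Fin 3 → ℕ
cᴬ = triple 1 1 2
cᴮ = triple 2 2 1

cᴬ-range : ∀ i → InRange 2 (cᴬ i)
cᴬ-range = triple-range (s≤s z≤n , s≤s z≤n) (s≤s z≤n , s≤s z≤n) (s≤s z≤n , s≤s (s≤s z≤n))

cᴮ-range : ∀ i → InRange 2 (cᴮ i)
cᴮ-range = triple-range (s≤s z≤n , s≤s (s≤s z≤n)) (s≤s z≤n , s≤s (s≤s z≤n)) (s≤s z≤n , s≤s z≤n)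

cᴬ-separates : ∀ {a m} → a ℕ.< m → Distinct₃ (partσ (triple a a m) cᴬ e₁₂)
cᴬ-separates {a} a<m with m≤n⇒∃[o]m+o≡n a<m
... | k , refl = Distinct₃-resp-≗ (partσ-Fin3 (triple a a (suc a + k)) cᴬ e₁₂)
  ( ≢-by-gap z<s (σ₁≡σ₀+m a k)
  , (λ σ₀≡σ₂ → d*m≢1+d*n 3 (suc a + k) a (s≤s (s≤s z≤n))
       (+-cancelˡ-≡ (1 + a * 2) _ _ (trans (sym (σ₀≡ a k)) (trans σ₀≡σ₂ (σ₂≡ a)))))
  , ≢-sym (≢-by-gap z<s (σ₁≡σ₂+gap a k)) )
  where
  σ₁≡σ₀+m : ∀ a k → 1 + a * 2 + (suc a + k) * 4 ≡ 1 + a * 2 + (suc a + k) * 3 + (suc a + k)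
  σ₁≡σ₀+m = solve-∀
  σ₀≡ : ∀ a k → 1 + a * 2 + (suc a + k) * 3 ≡ 1 + a * 2 + 3 * (suc a + k)
  σ₀≡ = solve-∀
  σ₂≡ : ∀ a → 2 + a * 2 + a * 3 ≡ 1 + a * 2 + (1 + 3 * a)
  σ₂≡ = solve-∀
  σ₁≡σ₂+gap : ∀ a k → 1 + a * 2 + (suc a + k) * 4 ≡ 2 + a * 2 + a * 3 + (3 + a + k * 4)
  σ₁≡σ₂+gap = solve-∀

cᴮ-separates : ∀ {a m} → 2 ≤ a → 1 ≤ m → m ≤ a → Distinct₃ (partσ (triple a a m) cᴮ e₁₂)
cᴮ-separates {a} {m} 1<a 0<m m≤a = Distinct₃-resp-≗ (partσ-Fin3 (triple a a m) cᴮ e₁₂)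
  ( ≢-by-gap 0<m (σ₁≡σ₀+m a m)
  , (λ σ₀≡σ₂ → d*m≢1+d*n 2 (2 * a) m (s≤s (s≤s z≤n))
       (+-cancelˡ-≡ (1 + a * 3) _ _ (trans (sym (σ₂≡ a)) (trans (sym σ₀≡σ₂) (σ₀≡ a m)))))
  , <⇒≢ σ₁<σ₂ )
  where
  σ₁≡σ₀+m : ∀ a m → 2 + a * 3 + m * 3 ≡ 2 + a * 3 + m * 2 + m
  σ₁≡σ₀+m = solve-∀
  σ₀≡ : ∀ a m → 2 + a * 3 + m * 2 ≡ 1 + a * 3 + (1 + 2 * m)
  σ₀≡ = solve-∀
  σ₂≡ : ∀ a → 1 + a * 3 + a * 4 ≡ 1 + a * 3 + 2 * (2 * a)
  σ₂≡ = solve-∀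
  split-1 : ∀ a → 2 + a * 3 + a * 3 ≡ 1 + a * 3 + a * 3 + 1
  split-1 = solve-∀
  split-a : ∀ a → 1 + a * 3 + a * 3 + a ≡ 1 + a * 3 + a * 4
  split-a = solve-∀

  σ₁<σ₂ : 2 + a * 3 + m * 3 ℕ.< 1 + a * 3 + a * 4
  σ₁<σ₂ = begin-strict
    2 + a * 3 + m * 3      ≤⟨ +-monoʳ-≤ (2 + a * 3) (*-monoˡ-≤ 3 m≤a) ⟩
    2 + a * 3 + a * 3      ≡⟨ split-1 a ⟩
    1 + a * 3 + a * 3 + 1  <⟨ +-monoʳ-< (1 + a * 3 + a * 3) 1<a ⟩
    1 + a * 3 + a * 3 + a  ≡⟨ split-a a ⟩
    1 + a * 3 + a * 4      ∎
    where open ≤-Reasoning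

module CompleteTripartite {n} {G : Graph n} {part : Fin n → Fin 3}
  (complete : IsComplete3PartiteWith G part) where

  open CompleteMultipartite G part (proj₂ complete) public

  rep : Fin 3 → Fin n
  rep i = proj₁ (proj₁ complete i)

  part∘rep : ∀ i → part (rep i) ≡ i
  part∘rep i = proj₂ (proj₁ complete i)

  size-pos : ∀ i → 1 ≤ size i
  size-pos i = ∈-length (∈-filter⁺ (λ u → part u ≟ i) (∈-allFin (rep i)) (part∘rep i))

  ≅K₃-if-size≡1 : (∀ i → size i ≡ 1) → G ≅ K₃
  ≅K₃-if-size≡1 size≡1 = part , rep , rep∘part , part∘rep , proj₂ complete
    where
    rep∘part : ∀ v → rep (part v) ≡ v
    rep∘part v = decidable-stable (rep (part v) ≟ v) λ rep≢v →
      n≮n 1 (subst (2 ≤_) (size≡1 (part v)) (∈-≢-∈⇒2≤length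
        (∈-filter⁺ (λ u → part u ≟ part v) (∈-allFin (rep (part v))) (part∘rep (part v)))
        (∈-filter⁺ (λ u → part u ≟ part v) (∈-allFin v) refl)
        rep≢v))

  ¬HasNFSD-1-if-size≡ : ∀ {i j} → i ≢ j → size i ≡ size j → ¬ HasNFSD G 1
  ¬HasNFSD-1-if-size≡ {i} {j} i≢j size≡ =
    ¬HasNFSD-1 (λ eq → i≢j (trans (sym (part∘rep i)) (trans eq (part∘rep j))))
      (subst₂ (λ x y → uniformσ size x ≡ uniformσ size y) (sym (part∘rep i)) (sym (part∘rep j))
              (from (uniformσ-≡⇔ size i j) size≡))

  hasNFSD₂-if-Distinct₃ : size 0F ≡ size 1F → ∀ c → (∀ i → InRange 2 (c i)) →
    Distinct₃ (partσ (triple (size 0F) (size 0F) (size 2F)) c e₁₂) → HasNFSD G 2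
  hasNFSD₂-if-Distinct₃ size₀≡size₁ c c-range distinct =
    hasNFSD-if-partσ-injective 2 c e₁₂ e₁₂-sym c-range e₁₂-range
      (Distinct₃⇒≢ (Distinct₃-resp-≗ (partσ-cong c e₁₂ size≗) distinct))
    where
    size≗ : size ≗ triple (size 0F) (size 0F) (size 2F)
    size≗ 0F = refl
    size≗ 1F = sym size₀≡size₁
    size≗ 2F = refl

  2≤size₀ : ¬ G ≅ K₃ → size 0F ≡ size 1F → size 2F ≤ size 0F → 2 ≤ size 0F
  2≤size₀ ≇K₃ size₀≡size₁ size₂≤size₀ = ≤∧≢⇒< (size-pos 0F) λ 1≡size₀ → ≇K₃ (≅K₃-if-size≡1 λ
    { 0F → sym 1≡size₀
    ; 1F → trans (sym size₀≡size₁) (sym 1≡size₀)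
    ; 2F → ≤-antisym (subst (size 2F ≤_) (sym 1≡size₀) size₂≤size₀) (size-pos 2F)
    })

  hasNFSD₂-if-size₀≡size₁ : ¬ G ≅ K₃ → size 0F ≡ size 1F → HasNFSD G 2
  hasNFSD₂-if-size₀≡size₁ ≇K₃ size₀≡size₁ with size 2F ≤? size 0F
  ... | no size₂≰size₀ =
    hasNFSD₂-if-Distinct₃ size₀≡size₁ cᴬ cᴬ-range (cᴬ-separates (≰⇒> size₂≰size₀))
  ... | yes size₂≤size₀ =
    hasNFSD₂-if-Distinct₃ size₀≡size₁ cᴮ cᴮ-range
      (cᴮ-separates (2≤size₀ ≇K₃ size₀≡size₁ size₂≤size₀) (size-pos 2F) size₂≤size₀)

hasNFSD₂-if-relabelled-size₀≡size₁ : ∀ {n} {G : Graph n} {part} (π : Permutation′ 3) →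
  IsComplete3PartiteWith G part → ¬ G ≅ K₃ →
  partSize part (π ⟨$⟩ˡ 0F) ≡ partSize part (π ⟨$⟩ˡ 1F) → HasNFSD G 2
hasNFSD₂-if-relabelled-size₀≡size₁ {G = G} {part} π complete ≇K₃ size≡ =
  CompleteTripartite.hasNFSD₂-if-size₀≡size₁ {part = (π ⟨$⟩ʳ_) ∘ part}
    (relabel-complete {G = G} π complete) ≇K₃
    (trans (count-relabel π part (allFin _) 0F) (trans size≡ (sym (count-relabel π part (allFin _) 1F))))

hasNFSD₂-if-equal-pair : ∀ {n} {G : Graph n} {part} → IsComplete3PartiteWith G part → ¬ G ≅ K₃ →
  ∀ {i j} → i < j → partSize part i ≡ partSize part j → HasNFSD G 2
hasNFSD₂-if-equal-pair complete ≇K₃ {0F} {1F} _ eq =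
  hasNFSD₂-if-relabelled-size₀≡size₁ id complete ≇K₃ eq
hasNFSD₂-if-equal-pair complete ≇K₃ {0F} {2F} _ eq =
  hasNFSD₂-if-relabelled-size₀≡size₁ (transpose 1F 2F) complete ≇K₃ eq
hasNFSD₂-if-equal-pair complete ≇K₃ {1F} {2F} _ eq =
  hasNFSD₂-if-relabelled-size₀≡size₁ (transpose 0F 2F) complete ≇K₃ (sym eq)
hasNFSD₂-if-equal-pair _ _ {0F} {0F} ()
hasNFSD₂-if-equal-pair _ _ {1F} {0F} ()
hasNFSD₂-if-equal-pair _ _ {1F} {1F} (s≤s ())
hasNFSD₂-if-equal-pair _ _ {2F} {0F} ()
hasNFSD₂-if-equal-pair _ _ {2F} {1F} (s≤s ())
hasNFSD₂-if-equal-pair _ _ {2F} {2F} (s≤s (s≤s ()))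

χven≡1 : ∀ {n} {G : Graph n} {part} → IsComplete3PartiteWith G part →
  (∀ i j → i < j → partSize part i ≢ partSize part j) → χven≡ G 1
χven≡1 complete distinct = χven≡-intro
  (hasNFSD-if-partσ-injective 1 (λ _ → 1) (λ _ _ → 1) (λ _ _ → refl)
    (λ _ → ≤-refl , ≤-refl) (λ _ _ → ≤-refl , ≤-refl)
    (λ i≢j → <-distinct⇒injective size distinct i≢j ∘ to (uniformσ-≡⇔ size _ _)))
  λ { z<s → ¬HasNFSD-0 (rep 0F) }
  where open CompleteTripartite complete

χven≡2 : ∀ {n} {G : Graph n} {part} → IsComplete3PartiteWith G part → ¬ G ≅ K₃ →
  ¬ (∀ i j → i < j → partSize part i ≢ partSize part j) → χven≡ G 2
χven≡2 {part = part} complete ≇K₃ ¬distinct =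
  let i , j , i<j , size≡ = ¬<-distinct⇒equal-pair (partSize part) ¬distinct
  in χven≡-intro (hasNFSD₂-if-equal-pair complete ≇K₃ i<j size≡) λ
       { z<s       → ¬HasNFSD-0 (rep i)
       ; (s≤s z<s) → ¬HasNFSD-1-if-size≡ (FinP.<⇒≢ i<j) size≡
       }
  where open CompleteTripartite complete

theorem2p2 : ∀ {n} (G : Graph n) (part : Fin n → Fin 3) →
    IsComplete3PartiteWith G part → ¬ (G ≅ K₃) →
    ((∀ i j → i < j → partSize part i ≢ partSize part j) → χven≡ G 1) ×
    (¬ (∀ i j → i < j → partSize part i ≢ partSize part j) → χven≡ G 2)
theorem2p2 G part complete ≇K₃ = χven≡1 complete , χven≡2 complete ≇K₃
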